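{- For every finite two-graph $\mathbf A$ there exists a finite two-graph $\mathbf B$ such that every graph in the switching class of $\mathbf B$ contains (as an induced subgraph) a copy of every graph in the switching class of $\mathbf A$.
   Context: A two-graph is a 3-uniform hypergraph in which every 4-vertex set contains an even number of hyperedges. For a graph $\mathbf G$, its associated two-graph $T(\mathbf G)$ has the same vertex set, with $\{a,b,c\}$ a hyperedge iff the subgraph of $\mathbf G$ induced on $\{a,b,c\}$ has an odd number of edges. For $S\subseteq G$, the switching $\mathbf G_S$ is obtained from $\mathbf G$ by complementing all edges/non-edges between $S$ and $G\setminus S$. The switching class of a two-graph $\mathbf T$ is the set of graphs $\mathbf G$ on the vertex set of $\mathbf T$ with $T(\mathbf G)=\mathbf T$; it consists of all switchings $\mathbf G_S$ of any one of its members. -}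

module Defs where

open import Data.Nat using (ℕ)
open import Data.Fin using (Fin)
open import Data.Bool using (Bool; true; false; _xor_)
open import Data.Product using (Σ; _×_)
open import Relation.Binary.PropositionalEquality using (_≡_; _≢_)
open import Function.Definitions using (Injective)

record Graph (n : ℕ) : Set where
  field
    adj   : Fin n → Fin n → Bool
    sym   : ∀ a b → adj a b ≡ adj b a
    irrefl : ∀ a → adj a a ≡ false
open Graph public

Distinct3 : ∀ {n} → Fin n → Fin n → Fin n → Set
Distinct3 a b c = a ≢ b × a ≢ c × b ≢ c

Distinct4 : ∀ {n} → Fin n → Fin n → Fin n → Fin n → Set
Distinct4 a b c d = a ≢ b × a ≢ c × a ≢ d × b ≢ c × b ≢ d × c ≢ d

-- A finite two-graph on Fin n: a 3-uniform hypergraph, given by the indicator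
-- edge a b c of whether {a,b,c} is a hyperedge (meaningful only for distinct
-- a,b,c; it is required to be invariant under permuting the arguments, and to
-- vanish on non-distinct triples so that it is a genuine set of 3-subsets),
-- such that every 4-set contains an even number of hyperedges.
record TwoGraph (n : ℕ) : Set where
  field
    edge     : Fin n → Fin n → Fin n → Bool
    swap₁₂   : ∀ a b c → edge a b c ≡ edge b a c
    swap₂₃   : ∀ a b c → edge a b c ≡ edge a c b
    nondeg   : ∀ a b c → edge a b c ≡ true → Distinct3 a b c
    even4    : ∀ a b c d → Distinct4 a b c d →
               (edge a b c xor edge a b d xor edge a c d xor edge b c d) ≡ false
open TwoGraph public

oddTriangle : ∀ {n} → Graph n → Fin n → Fin n → Fin n → Bool
oddTriangle G a b c = adj G a b xor adj G a c xor adj G b c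

-- G lies in the switching class of T, i.e. T(G) = T.
InSwitchingClass : ∀ {n} → TwoGraph n → Graph n → Set
InSwitchingClass T G =
  ∀ a b c → Distinct3 a b c → edge T a b c ≡ oddTriangle G a b c

InducedCopy : ∀ {m n} → Graph m → Graph n → Set
InducedCopy {m} {n} H G =
  Σ (Fin m → Fin n) λ f → Injective _≡_ _≡_ f × (∀ i j → adj H i j ≡ adj G (f i) (f j))

module Submission where

-- Write T(G) for the two-graph of triples inducing an odd number of edges of
-- G, and say G' is the switching of G by S ⊆ V when G' x y = G x y ⊕ S x ⊕ S y.
--  * Every two-graph T has a representative: for a basepoint v, the link
--    x ~ y ⇔ {v,x,y} ∈ T lies in the switching class of T (by the 4-set
--    condition on {v,a,b,c}).  Two graphs of one class have the same triangle
--    parities, hence are switchings of each other by S x = G v x ⊕ G' v x.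
--  * Switching by a set that is constant on an induced copy keeps it induced.
--  * Both constructions below are "fibred" graphs on Fin p × Fin q, with one
--    rule inside a fibre {x} × Fin q and one rule across fibres.  The doubling
--    D(H) ((i,a) ~ (j,b) iff i ≠ j and H i j ⊕ a ⊕ b) contains every switching
--    of H on the section i ↦ (i, S i).  The lexicographic square F[F] contains
--    F on every fibre and every section; for any switching set S either some
--    fibre avoids S or every fibre meets it, so every switching of F[F]
--    contains F.
-- Hence B = T(F[F]) with F = D(H₀), H₀ a representative of A, does the job.

open import Defs hiding (sym)
open import Data.Nat using (ℕ; zero; suc; _*_)
open import Data.Product using (Σ; ∃; _×_; _,_; proj₁; proj₂)
open import Data.Sum using (_⊎_; inj₁; inj₂)
open import Data.Bool using (Bool; true; false; _xor_)
open import Data.Bool.Properties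
  using (xor-∧-commutativeRing; xor-same; xor-identityʳ; ¬-not)
  renaming (_≟_ to _≟ᵇ_)
open import Data.Fin using (Fin; zero; suc; _≟_; combine; remQuot)
open import Data.Fin.Properties
  using (remQuot-combine; combine-injectiveˡ; combine-injectiveʳ; all?; any?; ¬∀⟶∃¬)
open import Relation.Binary.PropositionalEquality
open import Relation.Nullary using (Dec; yes; no; ¬_; contradiction)
open import Relation.Nullary.Decidable using (¬?; _×-dec_)
open import Algebra.Solver.Ring.AlmostCommutativeRing using (fromCommutativeRing)
import Algebra.Solver.Ring.Simple as RingSolver

open ≡-Reasoning

open RingSolver (fromCommutativeRing xor-∧-commutativeRing) _≟ᵇ_
  using (solve; _:+_; _:=_; con)

private
  variable
    m n : ℕ

xor≡false⇒≡ : ∀ x y → x xor y ≡ false → x ≡ y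
xor≡false⇒≡ false false _ = refl
xor≡false⇒≡ true  true  _ = refl
xor≡false⇒≡ false true  ()
xor≡false⇒≡ true  false ()

last-of-four : ∀ p q r s → (p xor q xor r xor s) ≡ false → s ≡ (p xor q xor r)
last-of-four p q r s even = xor≡false⇒≡ s (p xor q xor r) (trans (regroup p q r s) even)
  where
  regroup : ∀ p q r s → (s xor (p xor q xor r)) ≡ (p xor q xor r xor s)
  regroup = solve 4 (λ p q r s → s :+ (p :+ (q :+ r)) := p :+ (q :+ (r :+ s))) refl

-- Two triangles with equal parity: the third edge changes by the changes of
-- the other two.  This is what makes equal parities a switching.
parity-transfer : ∀ a b c a' b' c' → (a xor b xor c) ≡ (a' xor b' xor c') →
                  c' ≡ (c xor ((a xor a') xor (b xor b')))
parity-transfer a b c a' b' c' e = xor≡false⇒≡ _ _ (begin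
  c' xor (c xor ((a xor a') xor (b xor b')))  ≡⟨ regroup a b c a' b' c' ⟩
  (a xor b xor c) xor (a' xor b' xor c')      ≡⟨ cong (_xor (a' xor b' xor c')) e ⟩
  (a' xor b' xor c') xor (a' xor b' xor c')   ≡⟨ xor-same (a' xor b' xor c') ⟩
  false                                       ∎)
  where
  regroup : ∀ a b c a' b' c' → (c' xor (c xor ((a xor a') xor (b xor b'))))
                             ≡ ((a xor b xor c) xor (a' xor b' xor c'))
  regroup = solve 6 (λ a b c a' b' c' →
    c' :+ (c :+ ((a :+ a') :+ (b :+ b'))) := (a :+ (b :+ c)) :+ (a' :+ (b' :+ c'))) refl

-- The six edges of a 4-set: the four triangle parities sum to zero, since
-- every edge lies in exactly two of the triangles.
triangles-of-four : ∀ ab ac ad bc bd cd →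
  ((ab xor ac xor bc) xor (ab xor ad xor bd) xor (ac xor ad xor cd) xor (bc xor bd xor cd)) ≡ false
triangles-of-four = solve 6 (λ ab ac ad bc bd cd →
  (ab :+ (ac :+ bc)) :+ ((ab :+ (ad :+ bd)) :+ ((ac :+ (ad :+ cd)) :+ (bc :+ (bd :+ cd))))
    := con false) refl

distinct3? : (a b c : Fin n) → Dec (Distinct3 a b c)
distinct3? a b c = ¬? (a ≟ b) ×-dec ¬? (a ≟ c) ×-dec ¬? (b ≟ c)

-- On a degenerate triple the edges of a graph cancel in pairs.
degenerate-parity : (G : Graph n) (a b c : Fin n) → ¬ Distinct3 a b c → oddTriangle G a b c ≡ false
degenerate-parity G a b c ¬d with a ≟ b | a ≟ c | b ≟ c
... | yes refl | _ | _ rewrite irrefl G a = xor-same (adj G a c)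
... | no _ | yes refl | _ rewrite irrefl G a | Graph.sym G b a = xor-same (adj G a b)
... | no _ | no _ | yes refl rewrite irrefl G b | xor-identityʳ (adj G a b) = xor-same (adj G a b)
... | no a≢b | no a≢c | no b≢c = contradiction (a≢b , a≢c , b≢c) ¬d

parity-distinct : (G : Graph n) (a b c : Fin n) → oddTriangle G a b c ≡ true → Distinct3 a b c
parity-distinct G a b c odd with distinct3? a b c
... | yes d = d
... | no ¬d with () ← trans (sym odd) (degenerate-parity G a b c ¬d)

parity-swap₁₂ : (G : Graph n) (a b c : Fin n) → oddTriangle G a b c ≡ oddTriangle G b a c
parity-swap₁₂ G a b c rewrite Graph.sym G a b =
  solve 3 (λ x y z → x :+ (y :+ z) := x :+ (z :+ y)) refl (adj G b a) (adj G a c) (adj G b c)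

parity-swap₂₃ : (G : Graph n) (a b c : Fin n) → oddTriangle G a b c ≡ oddTriangle G a c b
parity-swap₂₃ G a b c rewrite Graph.sym G c b =
  solve 3 (λ x y z → x :+ (y :+ z) := y :+ (x :+ z)) refl (adj G a b) (adj G a c) (adj G b c)

twoGraph : Graph n → TwoGraph n
twoGraph G = record
  { edge   = oddTriangle G
  ; swap₁₂ = parity-swap₁₂ G
  ; swap₂₃ = parity-swap₂₃ G
  ; nondeg = parity-distinct G
  ; even4  = λ a b c d _ → triangles-of-four
      (adj G a b) (adj G a c) (adj G a d) (adj G b c) (adj G b d) (adj G c d)
  }

twoGraph-class : (G : Graph n) → InSwitchingClass (twoGraph G) G
twoGraph-class G a b c _ = refl

same-parity : (T : TwoGraph n) (G G' : Graph n) → InSwitchingClass T G → InSwitchingClass T G' →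
              ∀ a b c → oddTriangle G a b c ≡ oddTriangle G' a b c
same-parity T G G' inG inG' a b c with distinct3? a b c
... | yes d  = trans (sym (inG a b c d)) (inG' a b c d)
... | no ¬d = trans (degenerate-parity G a b c ¬d) (sym (degenerate-parity G' a b c ¬d))

degenerate-edge : (T : TwoGraph n) (a b c : Fin n) → ¬ Distinct3 a b c → edge T a b c ≡ false
degenerate-edge T a b c ¬d = ¬-not (λ e → ¬d (nondeg T a b c e))

link : TwoGraph n → Fin n → Graph n
link T v = record
  { adj    = edge T v
  ; sym    = swap₂₃ T v
  ; irrefl = λ x → degenerate-edge T v x x (λ (_ , _ , x≢x) → x≢x refl)
  }

link-class : (T : TwoGraph n) (v : Fin n) → InSwitchingClass T (link T v)
link-class T v a b c (a≢b , a≢c , b≢c) with v ≟ a | v ≟ b | v ≟ c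
... | yes refl | _ | _
  rewrite degenerate-edge T v v b (λ (v≢v , _) → v≢v refl)
        | degenerate-edge T v v c (λ (v≢v , _) → v≢v refl) = refl
... | no _ | yes refl | _
  rewrite degenerate-edge T v a v (λ (_ , v≢v , _) → v≢v refl)
        | degenerate-edge T v v c (λ (v≢v , _) → v≢v refl) =
  trans (swap₁₂ T a v c) (sym (xor-identityʳ (edge T v a c)))
... | no _ | no _ | yes refl
  rewrite degenerate-edge T v a v (λ (_ , v≢v , _) → v≢v refl)
        | degenerate-edge T v b v (λ (_ , v≢v , _) → v≢v refl) =
  trans (trans (swap₂₃ T a b v) (swap₁₂ T a v b)) (sym (xor-identityʳ (edge T v a b)))
... | no v≢a | no v≢b | no v≢c =
  last-of-four (edge T v a b) (edge T v a c) (edge T v b c) (edge T a b c)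
    (even4 T v a b c (v≢a , v≢b , v≢c , a≢b , a≢c , b≢c))

emptyGraph : Graph 0
emptyGraph = record { adj = λ () ; sym = λ () ; irrefl = λ () }

representative : (T : TwoGraph n) → Σ (Graph n) (InSwitchingClass T)
representative {zero}  T = emptyGraph , λ ()
representative {suc _} T = link T zero , link-class T zero

Switching : Graph n → (Fin n → Bool) → Graph n → Set
Switching G S G' = ∀ x y → adj G' x y ≡ (adj G x y xor (S x xor S y))

disagreement : Graph n → Graph n → Fin n → Fin n → Bool
disagreement G G' v x = adj G v x xor adj G' v x

switching-from-parities : (G G' : Graph n) (v : Fin n) →
  (∀ a b c → oddTriangle G a b c ≡ oddTriangle G' a b c) →
  Switching G (disagreement G G' v) G'
switching-from-parities G G' v same x y =
  parity-transfer (adj G v x) (adj G v y) (adj G x y) (adj G' v x) (adj G' v y) (adj G' x y)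
    (same v x y)

class-switching : (T : TwoGraph n) (G G' : Graph n) → InSwitchingClass T G → InSwitchingClass T G' →
                  Σ (Fin n → Bool) λ S → Switching G S G'
class-switching {zero}  T G G' _ _ = (λ ()) , λ ()
class-switching {suc _} T G G' inG inG' =
  disagreement G G' zero , switching-from-parities G G' zero (same-parity T G G' inG inG')

copy-trans : ∀ {k} {H : Graph k} {F : Graph m} {G : Graph n} →
             InducedCopy H F → InducedCopy F G → InducedCopy H G
copy-trans (f , f-inj , f-adj) (g , g-inj , g-adj) =
  (λ i → g (f i)) , (λ e → f-inj (g-inj e)) , λ i j → trans (f-adj i j) (g-adj (f i) (f j))

copy-survives-switching : {H : Graph m} (G G' : Graph n) (S : Fin n → Bool) → Switching G S G' →
  (copy : InducedCopy H G) (b : Bool) → (∀ i → S (proj₁ copy i) ≡ b) → InducedCopy H G'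
copy-survives-switching {H = H} G G' S switch (f , f-inj , f-adj) b constant =
  f , f-inj , λ i j → begin
    adj H i j                                    ≡⟨ f-adj i j ⟩
    adj G (f i) (f j)                            ≡⟨ xor-identityʳ _ ⟨
    adj G (f i) (f j) xor false                  ≡⟨ cong (adj G (f i) (f j) xor_) (xor-same b) ⟨
    adj G (f i) (f j) xor (b xor b)              ≡⟨ cong₂ (λ s t → adj G (f i) (f j) xor (s xor t))
                                                          (constant i) (constant j) ⟨
    adj G (f i) (f j) xor (S (f i) xor S (f j))  ≡⟨ switch (f i) (f j) ⟨
    adj G' (f i) (f j)                           ∎

-- Fibred graphs on Fin p × Fin q (encoded in Fin (p * q) by combine): one
-- rule for pairs in a common fibre {x} × Fin q, another across fibres.
record FibreRule (p q : ℕ) : Set where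
  field
    within        : Fin p → Fin q → Fin q → Bool
    between       : Fin p → Fin p → Fin q → Fin q → Bool
    within-sym    : ∀ x y y' → within x y y' ≡ within x y' y
    within-irrefl : ∀ x y → within x y y ≡ false
    between-sym   : ∀ x x' y y' → between x x' y y' ≡ between x' x y' y
open FibreRule

module _ {p q : ℕ} (R : FibreRule p q) where
  private
    rule : Fin p × Fin q → Fin p × Fin q → Bool
    rule (x , y) (x' , y') with x ≟ x'
    ... | yes _ = within R x y y'
    ... | no _  = between R x x' y y'

    rule-sym : ∀ u v → rule u v ≡ rule v u
    rule-sym (x , y) (x' , y') with x ≟ x' | x' ≟ x
    ... | yes refl | yes _     = within-sym R x y y'
    ... | no _     | no _      = between-sym R x x' y y'
    ... | yes refl | no x≢x    = contradiction refl x≢x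
    ... | no x≢x'  | yes refl  = contradiction refl x≢x'

    rule-irrefl : ∀ u → rule u u ≡ false
    rule-irrefl (x , y) with x ≟ x
    ... | yes _  = within-irrefl R x y
    ... | no x≢x = contradiction refl x≢x

  fibred : Graph (p * q)
  fibred = record
    { adj    = λ u v → rule (remQuot q u) (remQuot q v)
    ; sym    = λ u v → rule-sym (remQuot q u) (remQuot q v)
    ; irrefl = λ u → rule-irrefl (remQuot q u)
    }

  private
    adj-combine : ∀ x y x' y' → adj fibred (combine x y) (combine x' y') ≡ rule (x , y) (x' , y')
    adj-combine x y x' y' = cong₂ rule (remQuot-combine x y) (remQuot-combine x' y')

  fibred-within : ∀ x y y' → adj fibred (combine x y) (combine x y') ≡ within R x y y'
  fibred-within x y y' with x ≟ x | adj-combine x y x y'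
  ... | yes _  | e = e
  ... | no x≢x | _ = contradiction refl x≢x

  fibred-between : ∀ x x' y y' → x ≢ x' → adj fibred (combine x y) (combine x' y') ≡ between R x x' y y'
  fibred-between x x' y y' x≢x' with x ≟ x' | adj-combine x y x' y'
  ... | yes x≡x' | _ = contradiction x≡x' x≢x'
  ... | no _     | e = e

  fibre-copy : (H : Graph q) (x : Fin p) → (∀ y y' → adj H y y' ≡ within R x y y') →
               InducedCopy H fibred
  fibre-copy H x H-adj =
    combine x , (λ e → combine-injectiveʳ x _ x _ e) ,
    λ y y' → trans (H-adj y y') (sym (fibred-within x y y'))

  section-copy : (H : Graph p) (c : Fin p → Fin q) →
                 (∀ x x' → x ≢ x' → adj H x x' ≡ between R x x' (c x) (c x')) →
                 InducedCopy H fibred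
  section-copy H c H-adj = section , (λ e → combine-injectiveˡ _ _ _ _ e) , section-adj
    where
    section : Fin p → Fin (p * q)
    section x = combine x (c x)

    section-adj : ∀ x x' → adj H x x' ≡ adj fibred (section x) (section x')
    section-adj x x' with x ≟ x'
    ... | yes refl = trans (irrefl H x) (sym (irrefl fibred (section x)))
    ... | no x≢x'  = trans (H-adj x x' x≢x') (sym (fibred-between x x' (c x) (c x') x≢x'))

fibre-dichotomy : ∀ {p q} (S : Fin (p * q) → Bool) →
  (∃ λ x → ∀ y → S (combine x y) ≡ false) ⊎ (∀ x → ∃ λ y → S (combine x y) ≡ true)
fibre-dichotomy {p} {q} S = decide (all? meets?)
  where
  Meets : Fin p → Set
  Meets x = ∃ λ y → S (combine x y) ≡ true

  meets? : ∀ x → Dec (Meets x)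
  meets? x = any? (λ y → S (combine x y) ≟ᵇ true)

  decide : Dec (∀ x → Meets x) →
           (∃ λ x → ∀ y → S (combine x y) ≡ false) ⊎ (∀ x → Meets x)
  decide (yes meets) = inj₂ meets
  decide (no ¬meets) with (x , misses) ← ¬∀⟶∃¬ p Meets meets? ¬meets =
    inj₁ (x , λ y → ¬-not (λ e → misses (y , e)))

bit : Fin 2 → Bool
bit zero    = false
bit (suc _) = true

fromBool : Bool → Fin 2
fromBool false = zero
fromBool true  = suc zero

bit-fromBool : ∀ b → bit (fromBool b) ≡ b
bit-fromBool false = refl
bit-fromBool true  = refl

doubling : Graph m → Graph (m * 2)
doubling H = fibred record
  { within        = λ _ _ _ → false
  ; between       = λ i j a b → adj H i j xor (bit a xor bit b)
  ; within-sym    = λ _ _ _ → refl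
  ; within-irrefl = λ _ _ → refl
  ; between-sym   = λ i j a b →
      cong₂ _xor_ (Graph.sym H i j) (solve 2 (λ x y → x :+ y := y :+ x) refl (bit a) (bit b))
  }

doubling-universal : (H H' : Graph m) (S : Fin m → Bool) → Switching H S H' →
                     InducedCopy H' (doubling H)
doubling-universal H H' S switch = section-copy _ H' (λ i → fromBool (S i)) λ i j _ → begin
  adj H' i j                                              ≡⟨ switch i j ⟩
  adj H i j xor (S i xor S j)                             ≡⟨ cong₂ (λ s t → adj H i j xor (s xor t))
                                                                   (bit-fromBool (S i)) (bit-fromBool (S j)) ⟨
  adj H i j xor (bit (fromBool (S i)) xor bit (fromBool (S j)))  ∎

lexSquare : ∀ {p} → Graph p → Graph (p * p)
lexSquare F = fibred record
  { within        = λ _ → adj F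
  ; between       = λ x x' _ _ → adj F x x'
  ; within-sym    = λ _ → Graph.sym F
  ; within-irrefl = λ _ → irrefl F
  ; between-sym   = λ x x' _ _ → Graph.sym F x x'
  }

-- Every switching of F[F] contains F: on a fibre avoiding the switching set,
-- or else on a section inside it.
lexSquare-switching : ∀ {p} (F : Graph p) (G : Graph (p * p)) (S : Fin (p * p) → Bool) →
                      Switching (lexSquare F) S G → InducedCopy F G
lexSquare-switching F G S switch with fibre-dichotomy S
... | inj₁ (x , avoids) =
  copy-survives-switching {H = F} (lexSquare F) G S switch
    (fibre-copy _ F x λ _ _ → refl) false avoids
... | inj₂ meets =
  copy-survives-switching {H = F} (lexSquare F) G S switch
    (section-copy _ F (λ x → proj₁ (meets x)) λ _ _ _ → refl) true (λ x → proj₂ (meets x))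

proposition7p1 : (m : ℕ) (A : TwoGraph m) →
    Σ ℕ λ n → Σ (TwoGraph n) λ B →
      (G : Graph n) → InSwitchingClass B G →
      (H : Graph m) → InSwitchingClass A H →
      InducedCopy H G
proposition7p1 m A = (m * 2) * (m * 2) , twoGraph (lexSquare F) , contains-class
  where
  H₀ : Graph m
  H₀ = proj₁ (representative A)

  F : Graph (m * 2)
  F = doubling H₀

  contains-class : (G : Graph ((m * 2) * (m * 2))) → InSwitchingClass (twoGraph (lexSquare F)) G →
                   (H : Graph m) → InSwitchingClass A H → InducedCopy H G
  contains-class G inG H inH =
    let
        (S  , G-switch) = class-switching (twoGraph (lexSquare F)) (lexSquare F) G
                            (twoGraph-class (lexSquare F)) inG
        (S₀ , H-switch) = class-switching A H₀ H (proj₂ (representative A)) inH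
    in copy-trans {H = H} {F = F} {G = G}
         (doubling-universal H₀ H S₀ H-switch)
         (lexSquare-switching F G S G-switch)
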